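{- Let $G$ be a graph on $n$ vertices which is connected, asymmetric, $d$-regular, non-bipartite, and triangle-free. Then the complement $\overline{G}$ is rigid and $(n-d-1)$-regular.
   Context: Graphs are finite, simple and undirected. A graph is asymmetric if its only automorphism is the identity, and rigid if its only endomorphism (map of vertices sending edges to edges) is the identity. -}

module Defs where

open import Data.Nat using (ℕ; _+_)
open import Data.Bool using (Bool; true; false; not; _∧_; if_then_else_)
open import Data.Fin using (Fin; _≟_)
open import Data.List using (List; map; allFin)
open import Data.Nat.ListAction using (sum)
open import Data.Product using (Σ; _×_; ∃; ∃-syntax)
open import Relation.Binary.PropositionalEquality using (_≡_; _≢_)
open import Relation.Nullary using (¬_)
open import Relation.Nullary.Decidable using (⌊_⌋)
open import Function.Definitions using (Bijective)
open import Function.Bundles using (_⇔_)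
open import Relation.Binary.Construct.Closure.ReflexiveTransitive using (Star)

record Graph (n : ℕ) : Set where
  field
    adj   : Fin n → Fin n → Bool
    adj-sym   : ∀ u v → adj u v ≡ adj v u
    adj-irrfl : ∀ v → adj v v ≡ false
open Graph public

Edge : ∀ {n} → Graph n → Fin n → Fin n → Set
Edge G u v = adj G u v ≡ true

complement : ∀ {n} → Graph n → Graph n
complement {n} G = record
  { adj   = λ u v → not (adj G u v) ∧ not ⌊ u ≟ v ⌋
  ; adj-sym   = symc
  ; adj-irrfl = irr
  }
  where
  open import Relation.Binary.PropositionalEquality using (refl; sym; cong₂; cong)
  open import Relation.Nullary using (yes; no)
  symc : ∀ u v → (not (adj G u v) ∧ not ⌊ u ≟ v ⌋) ≡ (not (adj G v u) ∧ not ⌊ v ≟ u ⌋)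
  symc u v with u ≟ v | v ≟ u
  ... | yes _ | yes _ = cong₂ _∧_ (cong not (adj-sym G u v)) refl
  ... | no _  | no _  = cong₂ _∧_ (cong not (adj-sym G u v)) refl
  ... | yes p | no q  = Data.Empty.⊥-elim (q (sym p)) where import Data.Empty
  ... | no p  | yes q = Data.Empty.⊥-elim (p (sym q)) where import Data.Empty
  irr : ∀ v → (not (adj G v v) ∧ not ⌊ v ≟ v ⌋) ≡ false
  irr v with v ≟ v
  ... | yes _ = Data.Bool.Properties.∧-zeroʳ (not (adj G v v)) where import Data.Bool.Properties
  ... | no ¬p = Data.Empty.⊥-elim (¬p refl) where import Data.Empty

degree : ∀ {n} → Graph n → Fin n → ℕ
degree {n} G v = sum (map (λ u → if adj G v u then 1 else 0) (allFin n))

Regular : ∀ {n} → ℕ → Graph n → Set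
Regular d G = ∀ v → degree G v ≡ d

Connected : ∀ {n} → Graph n → Set
Connected G = ∀ u v → Star (Edge G) u v

Bipartite : ∀ {n} → Graph n → Set
Bipartite {n} G = Σ (Fin n → Bool) (λ c → ∀ (u v : Fin n) → Edge G u v → c u ≢ c v)

TriangleFree : ∀ {n} → Graph n → Set
TriangleFree {n} G = ∀ (u v w : Fin n) → ¬ (Edge G u v × Edge G v w × Edge G u w)

IsEndomorphism : ∀ {n} → Graph n → (Fin n → Fin n) → Set
IsEndomorphism G f = ∀ u v → Edge G u v → Edge G (f u) (f v)

IsAutomorphism : ∀ {n} → Graph n → (Fin n → Fin n) → Set
IsAutomorphism G f = Bijective _≡_ _≡_ f × (∀ u v → Edge G u v ⇔ Edge G (f u) (f v))

Asymmetric : ∀ {n} → Graph n → Set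
Asymmetric G = ∀ f → IsAutomorphism G f → ∀ v → f v ≡ v

Rigid : ∀ {n} → Graph n → Set
Rigid G = ∀ f → IsEndomorphism G f → ∀ v → f v ≡ v

{-# OPTIONS --safe #-}

-- An endomorphism f of Ḡ has an idempotent power e = fᵏ⁺¹. Distinct vertices identified by e are
-- adjacent in G, so every vertex x moved by e is adjacent to e x; by triangle-freeness e is injective
-- on the moved set S and every neighbour of the image P = e(S) is moved. Then |P| = |S|, and double
-- counting the edges between S and P in the d-regular graph G shows that every neighbour of a moved
-- vertex lies in P. By connectedness S ∪ P would be all of G with every edge joining S to P, a
-- bipartition; so S = ∅ and e = id. Thus f is invertible with inverse fᵏ, an automorphism of Ḡ and
-- hence of G, so f = id by asymmetry.
module Submission where

open import Defs
open import Data.Nat using (ℕ; _∸_)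
open import Data.Product using (_×_)
open import Relation.Nullary using (¬_)

open import Data.Bool using (Bool; true; false; not; _∧_; if_then_else_)
open import Data.Bool.Properties using (¬-not; not-¬; ∧-zeroʳ)
open import Data.Fin using (Fin; zero; suc; toℕ; _≟_; punchIn)
open import Data.Fin.Properties using (any?; punchInᵢ≢i; pigeonhole; toℕ<n)
open import Data.List using (tabulate)
open import Data.List.Properties using (map-tabulate)
import Data.Nat.ListAction as List
open import Data.Nat using (zero; suc; _+_; _*_; _≤_; z≤n; _!; pred; NonZero; ≢-nonZero; >-nonZero)
open import Data.Nat.Divisibility using (_∣_; quotient; ∣-trans; m∣m*n; m≤n⇒m!∣n!; ∣⇒≤)
open import Data.Nat.Properties renaming (_≟_ to _≟ℕ_)
open import Algebra.Properties.CommutativeSemigroup *-commutativeSemigroup using (x∙yz≈y∙xz)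
open import Algebra.Properties.Semiring.Sum +-*-semiring
  using ( sum; sum-syntax; sum-cong-≗; sum-replicate-zero; sum-remove
        ; ∑-comm; ∑-distrib-+; *-distribˡ-sum; *-distribʳ-sum)
open import Data.Product using (_,_; proj₁; proj₂; ∃; ∃-syntax)
open import Data.Sum using (_⊎_; inj₁; inj₂)
open import Function using (_∘_; id)
open import Function.Bundles using (mk⇔)
open import Function.Consequences.Propositional
  using (inverseᵇ⇒bijective; strictlyInverseˡ⇒inverseˡ; strictlyInverseʳ⇒inverseʳ)
open import Function.Definitions using (Bijective)
import Function.Endo.Propositional as Endo
open import Relation.Binary.Construct.Closure.ReflexiveTransitive using (Star; ε; _◅_)
open import Relation.Binary.PropositionalEquality
open import Relation.Nullary using (Dec; yes; no; ¬?; contradiction)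
open import Relation.Nullary.Decidable using (⌊_⌋; decidable-stable)
open import Relation.Unary using (Decidable)

χ : Bool → ℕ
χ b = if b then 1 else 0

χ≤1 : ∀ b → χ b ≤ 1
χ≤1 true  = ≤-refl
χ≤1 false = z≤n

⌊⌋≡true : ∀ {A : Set} (a? : Dec A) → A → ⌊ a? ⌋ ≡ true
⌊⌋≡true (yes _) _ = refl
⌊⌋≡true (no ¬a) a = contradiction a ¬a

⌊⌋≡false : ∀ {A : Set} (a? : Dec A) → ¬ A → ⌊ a? ⌋ ≡ false
⌊⌋≡false (yes a) ¬a = contradiction a ¬a
⌊⌋≡false (no _)  _  = refl

χ-toWitness : ∀ {A : Set} (a? : Dec A) → χ ⌊ a? ⌋ ≢ 0 → A
χ-toWitness (yes a) _   = a
χ-toWitness (no _)  χ≢0 = contradiction refl χ≢0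

∑-zero : ∀ {n} {f : Fin n → ℕ} → (∀ i → f i ≡ 0) → ∑[ i < n ] f i ≡ 0
∑-zero {n} f≗0 = trans (sum-cong-≗ f≗0) (sum-replicate-zero n)

∑-one : ∀ n → ∑[ i < n ] 1 ≡ n
∑-one zero    = refl
∑-one (suc n) = cong suc (∑-one n)

∑-supported : ∀ {n} (f : Fin n → ℕ) i → (∀ j → j ≢ i → f j ≡ 0) → ∑[ j < n ] f j ≡ f i
∑-supported {suc n} f i f≗0 = begin
  sum f                      ≡⟨ sum-remove f ⟩
  f i + sum (f ∘ punchIn i)  ≡⟨ cong (f i +_) (∑-zero (λ j → f≗0 _ (punchInᵢ≢i i j))) ⟩
  f i + 0                    ≡⟨ +-identityʳ (f i) ⟩
  f i                        ∎
  where open ≡-Reasoning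

∑-δ : ∀ {n} (i : Fin n) → ∑[ j < n ] χ ⌊ i ≟ j ⌋ ≡ 1
∑-δ i = trans (∑-supported _ i (λ j j≢i → cong χ (⌊⌋≡false (i ≟ j) (j≢i ∘ sym))))
              (cong χ (⌊⌋≡true (i ≟ i) refl))

∑≢0⇒∃≢0 : ∀ {n} (f : Fin n → ℕ) → ∑[ i < n ] f i ≢ 0 → ∃ λ i → f i ≢ 0
∑≢0⇒∃≢0 f ∑f≢0 with any? (λ i → ¬? (f i ≟ℕ 0))
... | yes ∃fi≢0 = ∃fi≢0
... | no  ∄fi≢0 = contradiction (∑-zero (λ i → decidable-stable (f i ≟ℕ 0) (∄fi≢0 ∘ (i ,_)))) ∑f≢0

∑-mono-≤ : ∀ {n} {f g : Fin n → ℕ} → (∀ i → f i ≤ g i) → ∑[ i < n ] f i ≤ ∑[ i < n ] g i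
∑-mono-≤ {zero}  f≤g = z≤n
∑-mono-≤ {suc n} f≤g = +-mono-≤ (f≤g zero) (∑-mono-≤ (f≤g ∘ suc))

≤-pointwise∧∑-≥⇒≗ : ∀ {n} {f g : Fin n → ℕ} →
  (∀ i → f i ≤ g i) → ∑[ i < n ] g i ≤ ∑[ i < n ] f i → ∀ i → f i ≡ g i
≤-pointwise∧∑-≥⇒≗ {suc n} {f} {g} f≤g ∑g≤∑f zero    = ≤-antisym (f≤g zero) head-≥
  where
  head-≥ : g zero ≤ f zero
  head-≥ = +-cancelʳ-≤ _ _ _ (≤-trans ∑g≤∑f (+-monoʳ-≤ (f zero) (∑-mono-≤ (f≤g ∘ suc))))
≤-pointwise∧∑-≥⇒≗ {suc n} {f} {g} f≤g ∑g≤∑f (suc i) = ≤-pointwise∧∑-≥⇒≗ (f≤g ∘ suc) tail-≥ i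
  where
  tail-≥ : ∑[ i < n ] g (suc i) ≤ ∑[ i < n ] f (suc i)
  tail-≥ = +-cancelˡ-≤ (g zero) _ _ (≤-trans ∑g≤∑f (+-monoˡ-≤ _ (f≤g zero)))

listSum-tabulate : ∀ {n} (f : Fin n → ℕ) → List.sum (tabulate f) ≡ ∑[ i < n ] f i
listSum-tabulate {zero}  f = refl
listSum-tabulate {suc n} f = cong (f zero +_) (listSum-tabulate (f ∘ suc))

degree≡∑ : ∀ {n} (G : Graph n) v → degree G v ≡ ∑[ u < n ] χ (adj G v u)
degree≡∑ G v = trans (cong List.sum (map-tabulate id (χ ∘ adj G v))) (listSum-tabulate (χ ∘ adj G v))

module _ {n : ℕ} (G : Graph n) where

  private
    Ḡ : Graph n
    Ḡ = complement G

  edge⇒≢ : ∀ {u v} → Edge G u v → u ≢ v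
  edge⇒≢ {u} uv refl = not-¬ (adj-irrfl G u) uv

  complement-edge : ∀ {u v} → u ≢ v → ¬ Edge G u v → Edge Ḡ u v
  complement-edge {u} {v} u≢v u≁v rewrite ⌊⌋≡false (u ≟ v) u≢v | ¬-not u≁v = refl

  complement-edge⇒≢ : ∀ {u v} → Edge Ḡ u v → u ≢ v
  complement-edge⇒≢ {u} {v} uv u≡v =
    not-¬ (trans (cong (λ b → not (adj G u v) ∧ not b) (⌊⌋≡true (u ≟ v) u≡v)) (∧-zeroʳ _)) uv

  complement-edge⇒≁ : ∀ {u v} → Edge Ḡ u v → ¬ Edge G u v
  complement-edge⇒≁ {u} {v} uv u~v = not-¬ (cong (λ b → not b ∧ not ⌊ u ≟ v ⌋) u~v) uv

  complement-≁⇒edge : ∀ {u v} → u ≢ v → ¬ Edge Ḡ u v → Edge G u v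
  complement-≁⇒edge u≢v u≁̄v = ¬-not (λ u≁v → u≁̄v (complement-edge u≢v (not-¬ u≁v)))

  degree-complement : ∀ v → degree G v + (degree Ḡ v + 1) ≡ n
  degree-complement v = begin
    degree G v + (degree Ḡ v + 1)  ≡⟨ cong₂ _+_ (degree≡∑ G v) (cong₂ _+_ (degree≡∑ Ḡ v) (sym (∑-δ v))) ⟩
    sum a + (sum ā + sum δ)        ≡⟨ cong (sum a +_) (∑-distrib-+ ā δ) ⟨
    sum a + sum (λ u → ā u + δ u)  ≡⟨ ∑-distrib-+ a (λ u → ā u + δ u) ⟨
    sum (λ u → a u + (ā u + δ u))  ≡⟨ sum-cong-≗ partition ⟩
    ∑[ u < n ] 1                   ≡⟨ ∑-one n ⟩
    n                              ∎
    where
    open ≡-Reasoning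
    a ā δ : Fin n → ℕ
    a u = χ (adj G v u)
    ā u = χ (adj Ḡ v u)
    δ u = χ ⌊ v ≟ u ⌋
    -- Ḡ's adjacency is spelled out so that `with v ≟ u` can abstract over it.
    partition : ∀ u → χ (adj G v u) + (χ (not (adj G v u) ∧ not ⌊ v ≟ u ⌋) + χ ⌊ v ≟ u ⌋) ≡ 1
    partition u with v ≟ u
    ... | yes refl rewrite adj-irrfl G v = refl
    ... | no _ with adj G v u
    ...   | true  = refl
    ...   | false = refl

  complement-regular : ∀ {d} → Regular d G → Regular (n ∸ d ∸ 1) Ḡ
  complement-regular {d} regular v = begin
    degree Ḡ v                                      ≡⟨ m+n∸n≡m (degree Ḡ v) 1 ⟨
    degree Ḡ v + 1 ∸ 1                              ≡⟨ cong (_∸ 1) (m+n∸m≡n (degree G v) _) ⟨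
    degree G v + (degree Ḡ v + 1) ∸ degree G v ∸ 1  ≡⟨ cong (λ m → m ∸ degree G v ∸ 1) (degree-complement v) ⟩
    n ∸ degree G v ∸ 1                              ≡⟨ cong (λ k → n ∸ k ∸ 1) (regular v) ⟩
    n ∸ d ∸ 1                                       ∎
    where open ≡-Reasoning

  automorphism-of-complement : ∀ {f g : Fin n → Fin n} →
    IsEndomorphism Ḡ f → IsEndomorphism Ḡ g → g ∘ f ≗ id → f ∘ g ≗ id → IsAutomorphism G f
  automorphism-of-complement {f} {g} f-endo g-endo g∘f≗id f∘g≗id =
    f-bijective , λ _ _ → mk⇔ preserves reflects
    where
    f-bijective : Bijective _≡_ _≡_ f
    f-bijective =
      inverseᵇ⇒bijective (strictlyInverseˡ⇒inverseˡ f f∘g≗id , strictlyInverseʳ⇒inverseʳ f g∘f≗id)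

    preserves : ∀ {u v} → Edge G u v → Edge G (f u) (f v)
    preserves {u} {v} uv = complement-≁⇒edge (edge⇒≢ uv ∘ proj₁ f-bijective) λ fu~̄fv →
      complement-edge⇒≁ (subst₂ (Edge Ḡ) (g∘f≗id u) (g∘f≗id v) (g-endo _ _ fu~̄fv)) uv

    reflects : ∀ {u v} → Edge G (f u) (f v) → Edge G u v
    reflects fuv = complement-≁⇒edge (edge⇒≢ fuv ∘ cong f) λ u~̄v →
      complement-edge⇒≁ (f-endo _ _ u~̄v) fuv

-- Double counting the κ-weighted edges at the support of σ gives d · ∑ κ, while each vertex
-- contributes at most d; since ∑ σ ≤ ∑ κ, every one of these bounds is attained.
regular-neighbourhood-transfer : ∀ {n d} (G : Graph n) → Regular d G → (σ κ : Fin n → ℕ) →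
  (∀ v → κ v ≤ 1) → sum σ ≤ sum κ → (∀ {v u} → κ v ≢ 0 → Edge G v u → σ u ≡ 1) →
  ∀ {u v} → σ u ≢ 0 → Edge G u v → κ v ≡ 1
regular-neighbourhood-transfer {n} {d} G regular σ κ κ≤1 ∑σ≤∑κ κ-closed {x} {y} σx≢0 xy = κy≡1
  where
  a : Fin n → Fin n → ℕ
  a u v = χ (adj G u v)

  row : ∀ u → sum (a u) ≡ d
  row u = trans (sym (degree≡∑ G u)) (regular u)

  κ-degree : Fin n → ℕ
  κ-degree u = ∑[ v < n ] (κ v * a u v)

  κa≤a : ∀ u v → κ v * a u v ≤ a u v
  κa≤a u v = ≤-trans (*-monoˡ-≤ (a u v) (κ≤1 v)) (≤-reflexive (*-identityˡ (a u v)))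

  κ-row : ∀ v → κ v * d ≡ κ v * ∑[ u < n ] (σ u * a v u)
  κ-row v with κ v ≟ℕ 0
  ... | yes κv≡0 rewrite κv≡0 = refl
  ... | no  κv≢0 = cong (κ v *_) (trans (sym (row v)) (sum-cong-≗ edge-into-σ))
    where
    edge-into-σ : ∀ u → a v u ≡ σ u * a v u
    edge-into-σ u with adj G v u in vu
    ... | true  = sym (trans (*-identityʳ (σ u)) (κ-closed κv≢0 vu))
    ... | false = sym (*-zeroʳ (σ u))

  double-count : sum κ * d ≡ ∑[ u < n ] (σ u * κ-degree u)
  double-count = begin
    sum κ * d                                    ≡⟨ *-distribʳ-sum d κ ⟩
    ∑[ v < n ] (κ v * d)                         ≡⟨ sum-cong-≗ κ-row ⟩
    ∑[ v < n ] (κ v * ∑[ u < n ] (σ u * a v u))  ≡⟨ sum-cong-≗ (λ v → *-distribˡ-sum (κ v) (σ-row v)) ⟩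
    ∑[ v < n ] ∑[ u < n ] (κ v * (σ u * a v u))  ≡⟨ ∑-comm (λ v u → κ v * (σ u * a v u)) ⟩
    ∑[ u < n ] ∑[ v < n ] (κ v * (σ u * a v u))  ≡⟨ sum-cong-≗ (λ u → sum-cong-≗ (swap u)) ⟩
    ∑[ u < n ] ∑[ v < n ] (σ u * (κ v * a u v))  ≡⟨ sum-cong-≗ (λ u → *-distribˡ-sum (σ u) (κ-row′ u)) ⟨
    ∑[ u < n ] (σ u * κ-degree u)                ∎
    where
    open ≡-Reasoning
    σ-row κ-row′ : Fin n → Fin n → ℕ
    σ-row  v u = σ u * a v u
    κ-row′ u v = κ v * a u v
    swap : ∀ u v → κ v * (σ u * a v u) ≡ σ u * (κ v * a u v)
    swap u v = trans (x∙yz≈y∙xz (κ v) (σ u) (a v u)) (cong (λ b → σ u * (κ v * χ b)) (adj-sym G v u))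

  κ-degree-tight : ∀ u → σ u * κ-degree u ≡ σ u * d
  κ-degree-tight = ≤-pointwise∧∑-≥⇒≗
    (λ u → *-monoʳ-≤ (σ u) (≤-trans (∑-mono-≤ (κa≤a u)) (≤-reflexive (row u))))
    (begin
      ∑[ u < n ] (σ u * d)           ≡⟨ *-distribʳ-sum d σ ⟨
      sum σ * d                      ≤⟨ *-monoˡ-≤ d ∑σ≤∑κ ⟩
      sum κ * d                      ≡⟨ double-count ⟩
      ∑[ u < n ] (σ u * κ-degree u)  ∎)
    where open ≤-Reasoning

  κ-degree-x≡d : κ-degree x ≡ d
  κ-degree-x≡d = *-cancelˡ-≡ _ _ (σ x) {{≢-nonZero σx≢0}} (κ-degree-tight x)

  κy≡1 : κ y ≡ 1
  κy≡1 = begin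
    κ y          ≡⟨ *-identityʳ (κ y) ⟨
    κ y * 1      ≡⟨ cong (λ b → κ y * χ b) xy ⟨
    κ y * a x y  ≡⟨ ≤-pointwise∧∑-≥⇒≗ (κa≤a x) (≤-reflexive (trans (row x) (sym κ-degree-x≡d))) y ⟩
    a x y        ≡⟨ cong χ xy ⟩
    1            ∎
    where open ≡-Reasoning

alternating⇒bipartite : ∀ {n} (G : Graph n) → Connected G → {X Y : Fin n → Set} → Decidable X →
  ∀ {x₀} → X x₀ → (∀ {u v} → X u → Edge G u v → Y v) → (∀ {u v} → Y u → Edge G u v → X v) →
  (∀ {v} → Y v → ¬ X v) → Bipartite G
alternating⇒bipartite G connected {X} {Y} X? {x₀} Xx₀ X→Y Y→X Y⇒¬X = (λ v → ⌊ X? v ⌋) , proper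
  where
  step : ∀ {u v} → X u ⊎ Y u → Edge G u v → X v ⊎ Y v
  step (inj₁ Xu) uv = inj₂ (X→Y Xu uv)
  step (inj₂ Yu) uv = inj₁ (Y→X Yu uv)

  walk : ∀ {u v} → X u ⊎ Y u → Star (Edge G) u v → X v ⊎ Y v
  walk p ε        = p
  walk p (e ◅ es) = walk (step p e) es

  proper : ∀ u v → Edge G u v → ⌊ X? u ⌋ ≢ ⌊ X? v ⌋
  proper u v uv with walk (inj₁ Xx₀) (connected x₀ u)
  ... | inj₁ Xu rewrite ⌊⌋≡true (X? u) Xu | ⌊⌋≡false (X? v) (Y⇒¬X (X→Y Xu uv)) = λ ()
  ... | inj₂ Yu rewrite ⌊⌋≡false (X? u) (Y⇒¬X Yu) | ⌊⌋≡true (X? v) (Y→X Yu uv) = λ ()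

module IdempotentEndomorphismOfComplement {n : ℕ} (G : Graph n) {e : Fin n → Fin n}
  (endo : IsEndomorphism (complement G) e) (idem : ∀ x → e (e x) ≡ e x) where

  Moved : Fin n → Set
  Moved x = e x ≢ x

  moved? : Decidable Moved
  moved? x = ¬? (e x ≟ x)

  MovedImage : Fin n → Set
  MovedImage y = ∃ λ s → Moved s × e s ≡ y

  identified⇒adjacent : ∀ {x y} → x ≢ y → e x ≡ e y → Edge G x y
  identified⇒adjacent x≢y ex≡ey =
    complement-≁⇒edge G x≢y (λ x~̄y → complement-edge⇒≢ G (endo _ _ x~̄y) ex≡ey)

  moved⇒adjacent-to-image : ∀ {x} → Moved x → Edge G x (e x)
  moved⇒adjacent-to-image {x} mx = identified⇒adjacent (mx ∘ sym) (sym (idem x))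

  moved-image⇒fixed : ∀ {y} → MovedImage y → ¬ Moved y
  moved-image⇒fixed (s , _ , refl) moved = moved (idem s)

  module _ (triangle-free : TriangleFree G) where

    injective-on-moved : ∀ {x y} → Moved x → Moved y → e x ≡ e y → x ≡ y
    injective-on-moved {x} {y} mx my ex≡ey = decidable-stable (x ≟ y) λ x≢y →
      triangle-free x y (e x) ( identified⇒adjacent x≢y ex≡ey
                              , subst (Edge G y) (sym ex≡ey) (moved⇒adjacent-to-image my)
                              , moved⇒adjacent-to-image mx )

    moved-image-neighbour⇒moved : ∀ {y z} → MovedImage y → Edge G y z → Moved z
    moved-image-neighbour⇒moved {z = z} (s , ms , refl) es~z ez≡z = complement-edge⇒≁ G es~̄z es~z
      where
      s≢z : s ≢ z
      s≢z refl = ms ez≡z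
      s≁z : ¬ Edge G s z
      s≁z s~z = triangle-free _ _ _ (moved⇒adjacent-to-image ms , es~z , s~z)
      es~̄z : Edge (complement G) (e s) z
      es~̄z = subst (Edge (complement G) (e s)) ez≡z (endo _ _ (complement-edge G s≢z s≁z))

    𝟙-moved : Fin n → ℕ
    𝟙-moved x = χ ⌊ moved? x ⌋

    moved-preimage : Fin n → Fin n → ℕ
    moved-preimage x y = 𝟙-moved x * χ ⌊ e x ≟ y ⌋

    #moved-preimages : Fin n → ℕ
    #moved-preimages y = ∑[ x < n ] moved-preimage x y

    moved-preimage≢0 : ∀ {x y} → moved-preimage x y ≢ 0 → Moved x × e x ≡ y
    moved-preimage≢0 {x} {y} p≢0 =
      χ-toWitness (moved? x) (λ 𝟙x≡0 → p≢0 (cong (_* χ ⌊ e x ≟ y ⌋) 𝟙x≡0)) ,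
      χ-toWitness (e x ≟ y) (λ δ≡0 → p≢0 (trans (cong (𝟙-moved x *_) δ≡0) (*-zeroʳ (𝟙-moved x))))

    #moved-preimages≢0 : ∀ {y} → #moved-preimages y ≢ 0 → MovedImage y
    #moved-preimages≢0 #≢0 = let (x , p≢0) = ∑≢0⇒∃≢0 _ #≢0 in x , moved-preimage≢0 p≢0

    #moved-preimages≤1 : ∀ y → #moved-preimages y ≤ 1
    #moved-preimages≤1 y with #moved-preimages y ≟ℕ 0
    ... | yes #≡0 = ≤-trans (≤-reflexive #≡0) z≤n
    ... | no  #≢0 = let (x₀ , p≢0) = ∑≢0⇒∃≢0 _ #≢0 in begin
      #moved-preimages y  ≡⟨ ∑-supported _ x₀ (only-x₀ (moved-preimage≢0 p≢0)) ⟩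
      moved-preimage x₀ y ≤⟨ *-mono-≤ (χ≤1 ⌊ moved? x₀ ⌋) (χ≤1 ⌊ e x₀ ≟ y ⌋) ⟩
      1                   ∎
      where
      open ≤-Reasoning
      only-x₀ : ∀ {x₀} → Moved x₀ × e x₀ ≡ y → ∀ x → x ≢ x₀ → moved-preimage x y ≡ 0
      only-x₀ (mx₀ , ex₀≡y) x x≢x₀ = decidable-stable (_ ≟ℕ 0) λ p≢0 →
        let (mx , ex≡y) = moved-preimage≢0 p≢0
        in x≢x₀ (injective-on-moved mx mx₀ (trans ex≡y (sym ex₀≡y)))

    ∑#moved-preimages : sum #moved-preimages ≡ sum 𝟙-moved
    ∑#moved-preimages = begin
      ∑[ y < n ] ∑[ x < n ] moved-preimage x y           ≡⟨ ∑-comm moved-preimage ⟨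
      ∑[ x < n ] ∑[ y < n ] moved-preimage x y           ≡⟨ sum-cong-≗ (λ x → *-distribˡ-sum (𝟙-moved x) (δ x)) ⟨
      ∑[ x < n ] (𝟙-moved x * ∑[ y < n ] χ ⌊ e x ≟ y ⌋)  ≡⟨ sum-cong-≗ (λ x → cong (𝟙-moved x *_) (∑-δ (e x))) ⟩
      ∑[ x < n ] (𝟙-moved x * 1)                         ≡⟨ sum-cong-≗ (*-identityʳ ∘ 𝟙-moved) ⟩
      sum 𝟙-moved                                        ∎
      where
      open ≡-Reasoning
      δ : Fin n → Fin n → ℕ
      δ x y = χ ⌊ e x ≟ y ⌋

    moved-neighbour⇒moved-image : ∀ {d} → Regular d G → ∀ {x y} → Moved x → Edge G x y → MovedImage y
    moved-neighbour⇒moved-image regular {x} {y} mx xy =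
      #moved-preimages≢0 (λ #≡0 → 1+n≢0 (trans (sym #≡1) #≡0))
      where
      𝟙-moved≡1 : ∀ {x} → Moved x → 𝟙-moved x ≡ 1
      𝟙-moved≡1 {x} mx = cong χ (⌊⌋≡true (moved? x) mx)
      #≡1 : #moved-preimages y ≡ 1
      #≡1 = regular-neighbourhood-transfer G regular 𝟙-moved #moved-preimages #moved-preimages≤1
        (≤-reflexive (sym ∑#moved-preimages))
        (λ #≢0 vu → 𝟙-moved≡1 (moved-image-neighbour⇒moved (#moved-preimages≢0 #≢0) vu))
        (λ 𝟙≡0 → 1+n≢0 (trans (sym (𝟙-moved≡1 mx)) 𝟙≡0)) xy

  ≗id : TriangleFree G → ∀ {d} → Regular d G → Connected G → ¬ Bipartite G → e ≗ id
  ≗id triangle-free regular connected ¬bipartite x = decidable-stable (e x ≟ x) λ mx →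
    ¬bipartite (alternating⇒bipartite G connected moved? mx
      (moved-neighbour⇒moved-image triangle-free regular)
      (moved-image-neighbour⇒moved triangle-free)
      moved-image⇒fixed)

m≤n⇒m∣n! : ∀ {m n} .{{_ : NonZero m}} → m ≤ n → m ∣ n !
m≤n⇒m∣n! {suc m} m≤n = ∣-trans (m∣m*n (m !)) (m≤n⇒m!∣n! m≤n)

module _ {n : ℕ} where

  open Endo (Fin n) using (_^_; ^-homo)

  ^-+ : ∀ (f : Fin n → Fin n) i j x → (f ^ (i + j)) x ≡ (f ^ i) ((f ^ j) x)
  ^-+ f i j = cong-app (^-homo f i j)

  ^-comm : ∀ (f : Fin n → Fin n) i j x → (f ^ i) ((f ^ j) x) ≡ (f ^ j) ((f ^ i) x)
  ^-comm f i j x = trans (sym (^-+ f i j x)) (trans (cong (λ k → (f ^ k) x) (+-comm i j)) (^-+ f j i x))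

  ^-*-fixed : ∀ {f : Fin n → Fin n} {c y} → (f ^ c) y ≡ y → ∀ q → (f ^ (q * c)) y ≡ y
  ^-*-fixed             fᶜy≡y zero    = refl
  ^-*-fixed {f} {c} {y} fᶜy≡y (suc q) =
    trans (^-+ f c (q * c) y) (trans (cong (f ^ c) (^-*-fixed fᶜy≡y q)) fᶜy≡y)

  ^-endomorphism : ∀ (G : Graph n) {f} → IsEndomorphism G f → ∀ k → IsEndomorphism G (f ^ k)
  ^-endomorphism G endo zero    u v uv = uv
  ^-endomorphism G endo (suc k) u v uv = endo _ _ (^-endomorphism G endo k u v uv)

  ^-suc≗id⇒^∘f≗id : ∀ {f : Fin n → Fin n} {k} → f ^ suc k ≗ id → (f ^ k) ∘ f ≗ id
  ^-suc≗id⇒^∘f≗id {f} {k} fˢᵏ≗id x = trans (^-comm f k 1 x) (fˢᵏ≗id x)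

  -- By pigeonhole fᵃ x = fᶜ⁺ᵃ x for some 1 ≤ c ≤ n + 1; since c ∣ M = (n + 1)! and a ≤ M,
  -- the point fᴹ x lies on the cycle of x, on which fᴹ is the identity.
  ^-!-idempotent : ∀ (f : Fin n → Fin n) x → (f ^ (suc n !)) ((f ^ (suc n !)) x) ≡ (f ^ (suc n !)) x
  ^-!-idempotent f x with pigeonhole (n<1+n n) (λ i → (f ^ toℕ i) x)
  ... | i , j , i<j , fⁱx≡fʲx = begin
    (f ^ M) ((f ^ M) x)  ≡⟨ cong (f ^ M) fᴹx≡fᵗy ⟩
    (f ^ M) ((f ^ t) y)  ≡⟨ ^-comm f M t y ⟩
    (f ^ t) ((f ^ M) y)  ≡⟨ cong (f ^ t) fᴹy≡y ⟩
    (f ^ t) y            ≡⟨ fᴹx≡fᵗy ⟨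
    (f ^ M) x            ∎
    where
    open ≡-Reasoning
    M a c t : ℕ
    M = suc n !
    a = toℕ i
    c = toℕ j ∸ a
    t = M ∸ a
    y : Fin n
    y = (f ^ a) x
    fᶜy≡y : (f ^ c) y ≡ y
    fᶜy≡y = trans (sym (^-+ f c a x)) (trans (cong (λ k → (f ^ k) x) (m∸n+n≡m (<⇒≤ i<j))) (sym fⁱx≡fʲx))
    fᴹy≡y : (f ^ M) y ≡ y
    fᴹy≡y = trans (cong (λ k → (f ^ k) y) (_∣_.equality c∣M)) (^-*-fixed fᶜy≡y (quotient c∣M))
      where
      c∣M : c ∣ M
      c∣M = m≤n⇒m∣n! {{>-nonZero (m<n⇒0<n∸m i<j)}} (≤-trans (m∸n≤m (toℕ j) a) (<⇒≤ (toℕ<n j)))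
    fᴹx≡fᵗy : (f ^ M) x ≡ (f ^ t) y
    fᴹx≡fᵗy = trans (cong (λ k → (f ^ k) x) (sym (m∸n+n≡m a≤M))) (^-+ f t a x)
      where
      a≤M : a ≤ M
      a≤M = ≤-trans (<⇒≤ (toℕ<n i)) (∣⇒≤ {{suc n !≢0}} (m≤n⇒m∣n! ≤-refl))

  idempotent-power : ∀ (f : Fin n → Fin n) → ∃[ k ] ∀ x → (f ^ suc k) ((f ^ suc k) x) ≡ (f ^ suc k) x
  idempotent-power f = pred (suc n !) ,
    subst (λ m → ∀ x → (f ^ m) ((f ^ m) x) ≡ (f ^ m) x) (sym (suc-pred (suc n !) {{suc n !≢0}}))
          (^-!-idempotent f)

lemma3p2 : (n d : ℕ) (G : Graph n) →
    Connected G → Asymmetric G → Regular d G → ¬ Bipartite G → TriangleFree G →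
    Rigid (complement G) × Regular (n ∸ d ∸ 1) (complement G)
lemma3p2 n d G connected asymmetric regular ¬bipartite triangle-free = rigid , complement-regular G regular
  where
  open Endo (Fin n) using (_^_)

  rigid : Rigid (complement G)
  rigid f endo = asymmetric f
    (automorphism-of-complement G endo (^-endomorphism (complement G) endo k)
      (^-suc≗id⇒^∘f≗id {f = f} {k} fᵏ⁺¹≗id) fᵏ⁺¹≗id)
    where
    k : ℕ
    k = proj₁ (idempotent-power f)
    fᵏ⁺¹≗id : f ^ suc k ≗ id
    fᵏ⁺¹≗id = IdempotentEndomorphismOfComplement.≗id G
      (^-endomorphism (complement G) endo (suc k)) (proj₂ (idempotent-power f))
      triangle-free regular connected ¬bipartite
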